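{- Let $\Xi$ be a non-simple type, let $\{k_1,\ldots,k_s\}$ be the set of pairwise different white weights and $\{l_1,\ldots,l_t\}$ the set of pairwise different black weights occurring in $\Xi$, and suppose there are $m_i$ white vertices of weight $k_i$ ($i=1,\ldots,s$) and $n_j$ black vertices of weight $l_j$ ($j=1,\ldots,t$). Put $p=\prod_{i=1}^s m_i!\,\prod_{j=1}^t n_j!$. If the derivative type $\Xi'$ contains $N$ nonsymmetric w-trees and, for $i=2,3,\ldots$, $M_i$ w-trees with $i$-order symmetry, then $$|\Xi|=\frac{N}{p}+\sum_i\frac{iM_i}{p}.$$
   Context: A w-tree is a finite connected plane tree in which every vertex and every edge carries a positive integer weight, such that the weight of each vertex equals the sum of the weights of the edges incident to it; its vertices are properly 2-colored white and black. A type $\langle k_1,\ldots\,|\,l_1,\ldots\rangle$ (a list of white weights and a list of black weights with equal sums) is the set of w-trees with exactly the prescribed multiset of white vertex weights and of black vertex weights, up to orientation-preserving isotopy of the plane preserving colors and weights; $|\Xi|$ is the number of its elements. A type is simple if within each color all weights are pairwise distinct, and non-simple otherwise. The derivative type $\Xi'$ of $\Xi$ is obtained by labeling (numbering) the vertices, so that vertices of equal color and weight become distinguishable; its elements are w-trees of $\Xi$ with such a labeling, up to isotopy preserving colors, weights and labels. A w-tree of $\Xi'$ is nonsymmetric if the underlying (unlabeled) w-tree admits no nontrivial orientation-preserving self-homeomorphism of the plane preserving the tree, colors and weights, and it has $i$-order symmetry if the group of such symmetries of the underlying unlabeled w-tree has order $i$. -}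

module Defs where

open import Data.Nat using (ℕ; zero; suc; _+_; _*_; _≤_; _<_; _≟_; _!)
open import Data.Fin using (Fin)
import Data.Fin as F
open import Data.Fin.Permutation using (Permutation; Permutation′; _⟨$⟩ʳ_)
open import Data.List using (List; []; _∷_; length; map; filter; allFin; deduplicate; lookup)
open import Data.List.Relation.Unary.Any using (Any)
open import Data.Nat.ListAction using (sum; product)
open import Data.Sum using (_⊎_; inj₁; inj₂)
open import Data.Product using (Σ; ∃; _×_; _,_)
open import Relation.Binary.PropositionalEquality using (_≡_)
open import Relation.Nullary using (¬_)

Positive : List ℕ → Set
Positive xs = ∀ (i : Fin (length xs)) → 1 ≤ lookup xs i

HasRepeat : List ℕ → Set
HasRepeat xs = Σ (Fin (length xs)) λ i → Σ (Fin (length xs)) λ j →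
  ¬ (i ≡ j) × (lookup xs i ≡ lookup xs j)

NonSimple : List ℕ → List ℕ → Set
NonSimple ks ls = HasRepeat ks ⊎ HasRepeat ls

mult : ℕ → List ℕ → ℕ
mult k xs = length (filter (k ≟_) xs)

multFact : List ℕ → ℕ
multFact xs = product (map (λ k → (mult k xs) !) (deduplicate _≟_ xs))

pFactor : List ℕ → List ℕ → ℕ
pFactor ks ls = multFact ks * multFact ls

-- Plane bipartite trees, combinatorially (rotation systems).
-- White vertices are Fin (length ks), the i-th white vertex having weight
-- ks[i]; black vertices are Fin (length ls) likewise.  Edges are Fin E.
-- σ (resp. τ) gives the counterclockwise cyclic order of the edges around
-- each white (resp. black) vertex.

iter : ∀ {n} → (Fin n → Fin n) → ℕ → Fin n → Fin n
iter f zero x = x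
iter f (suc k) x = f (iter f k x)

incSum : ∀ {E m} → (Fin E → Fin m) → (Fin E → ℕ) → Fin m → ℕ
incSum {E} end w v = sum (map w (filter (λ e → end e F.≟ v) (allFin E)))

module _ {a b E : ℕ} (wv : Fin E → Fin a) (bv : Fin E → Fin b) where
  data Reach : Fin a ⊎ Fin b → Fin a ⊎ Fin b → Set where
    here : ∀ {x} → Reach x x
    wb   : ∀ {x} (e : Fin E) → Reach (inj₂ (bv e)) x → Reach (inj₁ (wv e)) x
    bw   : ∀ {x} (e : Fin E) → Reach (inj₁ (wv e)) x → Reach (inj₂ (bv e)) x

record WTree (ks ls : List ℕ) : Set where
  field
    E   : ℕ
    wv  : Fin E → Fin (length ks)
    bv  : Fin E → Fin (length ls)
    w   : Fin E → ℕ
    σ   : Permutation′ E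
    τ   : Permutation′ E
    w-pos    : ∀ e → 1 ≤ w e
    σ-fiber  : ∀ e → wv (σ ⟨$⟩ʳ e) ≡ wv e
    σ-cyclic : ∀ e e′ → wv e ≡ wv e′ → ∃ λ k → iter (σ ⟨$⟩ʳ_) k e ≡ e′
    τ-fiber  : ∀ e → bv (τ ⟨$⟩ʳ e) ≡ bv e
    τ-cyclic : ∀ e e′ → bv e ≡ bv e′ → ∃ λ k → iter (τ ⟨$⟩ʳ_) k e ≡ e′
    -- underlying graph is a tree
    connected : ∀ x y → Reach wv bv x y
    edges     : E + 1 ≡ length ks + length ls
    white-wt : ∀ v → incSum wv w v ≡ lookup ks v
    black-wt : ∀ v → incSum bv w v ≡ lookup ls v

open WTree

-- isomorphism of w-trees (orientation-preserving, colour- and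
-- weight-preserving); the vertices may be permuted
record Iso {ks ls} (T₁ T₂ : WTree ks ls) : Set where
  field
    φ : Permutation (E T₁) (E T₂)
    α : Permutation′ (length ks)
    β : Permutation′ (length ls)
    φ-wv : ∀ e → wv T₂ (φ ⟨$⟩ʳ e) ≡ α ⟨$⟩ʳ (wv T₁ e)
    φ-bv : ∀ e → bv T₂ (φ ⟨$⟩ʳ e) ≡ β ⟨$⟩ʳ (bv T₁ e)
    φ-w  : ∀ e → w T₂ (φ ⟨$⟩ʳ e) ≡ w T₁ e
    φ-σ  : ∀ e → σ T₂ ⟨$⟩ʳ (φ ⟨$⟩ʳ e) ≡ φ ⟨$⟩ʳ (σ T₁ ⟨$⟩ʳ e)
    φ-τ  : ∀ e → τ T₂ ⟨$⟩ʳ (φ ⟨$⟩ʳ e) ≡ φ ⟨$⟩ʳ (τ T₁ ⟨$⟩ʳ e)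

-- isomorphism of labelled w-trees (elements of Ξ′): labels are preserved
LIso : ∀ {ks ls} (T₁ T₂ : WTree ks ls) → Set
LIso T₁ T₂ = Σ (Iso T₁ T₂) λ i →
  (∀ v → Iso.α i ⟨$⟩ʳ v ≡ v) × (∀ v → Iso.β i ⟨$⟩ʳ v ≡ v)

IsClassList : {A : Set} → (A → A → Set) → List A → Set
IsClassList {A} R L =
  (∀ x → Σ (Fin (length L)) λ j → R x (lookup L j)) ×
  (∀ i j → R (lookup L i) (lookup L j) → i ≡ j)

-- |Ξ| and Ξ′ given by complete lists of representatives
IsΞ : (ks ls : List ℕ) → List (WTree ks ls) → Set
IsΞ ks ls = IsClassList Iso

IsΞ′ : (ks ls : List ℕ) → List (WTree ks ls) → Set
IsΞ′ ks ls = IsClassList LIso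

-- symmetries of the underlying unlabelled w-tree
Aut : ∀ {ks ls} → WTree ks ls → Set
Aut T = Iso T T

SameAut : ∀ {ks ls} {T : WTree ks ls} → Aut T → Aut T → Set
SameAut g h =
  (∀ e → Iso.φ g ⟨$⟩ʳ e ≡ Iso.φ h ⟨$⟩ʳ e) ×
  (∀ v → Iso.α g ⟨$⟩ʳ v ≡ Iso.α h ⟨$⟩ʳ v) ×
  (∀ v → Iso.β g ⟨$⟩ʳ v ≡ Iso.β h ⟨$⟩ʳ v)

SymOrder : ∀ {ks ls} → WTree ks ls → ℕ → Set
SymOrder T i = Σ (List (Aut T)) λ G →
  (length G ≡ i) ×
  (∀ g → Σ (Fin (length G)) λ j → SameAut g (lookup G j)) ×
  (∀ j j′ → SameAut (lookup G j) (lookup G j′) → j ≡ j′)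

countEq : ∀ {n} → (Fin n → ℕ) → ℕ → ℕ
countEq {n} f i = length (filter (λ j → f j ≟ i) (allFin n))

sumFrom2 : (ℕ → ℕ) → ℕ → ℕ
sumFrom2 M zero = 0
sumFrom2 M (suc zero) = 0
sumFrom2 M (suc (suc B)) = sumFrom2 M (suc B) + suc (suc B) * M (suc (suc B))

-- Count the flags (j , g), where j is a labelled w-tree of Ξ′ and g a symmetry of it, in two ways.
-- Grouping by j gives ∑ⱼ |Aut Ξ′ⱼ| = N + ∑ᵢ i Mᵢ.  On the other hand the flags correspond to the pairs
-- (i , h) of a w-tree of Ξ and a weight-preserving relabelling h of the vertices, of which there are
-- p = ∏ mᵢ! ∏ nⱼ!: fix for every j an isomorphism ψⱼ from Ξ′ⱼ to its representative in Ξ; then (j , g)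
-- goes to that representative with the vertex permutation of ψⱼ⁻¹ g, and (i , h) goes to the labelled
-- class j of the i-th w-tree relabelled by h with the automorphism ψⱼ μ, where μ is the relabelling
-- isomorphism.  Both maps reflect the equivalences, so the two counts agree.  Injectivity of the first
-- one uses that a tree has no parallel edges, so that an isomorphism is determined by its action on
-- the vertices.
module Submission where

open import Defs
open import Data.Bool using (true; false; if_then_else_)
open import Data.Empty using (⊥-elim)
open import Data.Fin as Fin using (Fin; zero; suc; splitAt; _↑ˡ_; _↑ʳ_; combine; remQuot)
open import Data.Fin.Permutation as Perm
  using ( Permutation; Permutation′; _⟨$⟩ʳ_; _⟨$⟩ˡ_; inverseˡ; inverseʳ; flip; _∘ₚ_
        ; lift₀; remove; lift₀-cong; lift₀-remove )
import Data.Fin.Permutation.Components as PC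
open import Data.Fin.Properties
  using ( suc-injective; toℕ<n; combine-injective; combine-remQuot; splitAt-↑ˡ; splitAt-↑ʳ; join-splitAt
        ; any?; injective⇒≤ )
open import Data.List using (List; []; _∷_; length; lookup; map; filter; tabulate; deduplicate)
open import Data.List.Properties using (map-cong-local; filter-accept; filter-reject)
open import Data.List.Relation.Unary.All as All using ()
open import Data.List.Relation.Unary.All.Properties using (all-filter)
open import Data.Nat using (ℕ; zero; suc; _+_; _*_; _^_; _!; _⊓_; _≤_; _<_; _≟_; z≤n; s≤s)
open import Data.Nat.ListAction using (sum; product)
open import Data.Nat.Properties
  using ( +-comm; +-identityʳ; *-assoc; *-comm; *-identityʳ; *-zeroʳ; ≤-refl; ≤-trans; ≤-antisym; ≤-pred
        ; m≤n⇒m≤1+n; m≤n⇒m<n∨m≡n; <⇒≢; >⇒≢; <-asym; n≮n; n≮0; m<n⇒0<n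
        ; +-0-commutativeMonoid; +-*-semiring; *-commutativeSemigroup )
open import Data.Product using (Σ; _×_; _,_; proj₁; proj₂)
open import Data.Product.Properties using (Σ-≡,≡←≡)
open import Data.Product.Relation.Binary.Pointwise.NonDependent using (Pointwise)
open import Data.Sum as Sum using (_⊎_; inj₁; inj₂)
open import Data.Sum.Properties using (≡-dec)
open import Function using (_∘_; _on_)
open import Relation.Binary.Structures using (IsEquivalence)
open import Relation.Binary.PropositionalEquality
open import Relation.Nullary using (¬_; ¬?; Dec; yes; no; does; contradiction)
open import Relation.Nullary.Decidable using (dec-true; dec-false; _×-dec_; _⊎-dec_)
open import Relation.Unary using (Pred; Decidable)

open import Algebra.Properties.CommutativeMonoid.Sum +-0-commutativeMonoid
  using (sum-syntax; sum-cong-≗; sum-replicate-zero; ∑-distrib-+; sum-permute)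
open import Algebra.Properties.Semiring.Sum +-*-semiring using (*-distribˡ-sum)
open import Algebra.Properties.CommutativeSemigroup *-commutativeSemigroup using (x∙yz≈y∙xz)

-- Sums over Fin and the count by symmetry order

δ : ℕ → ℕ → ℕ
δ x i = if does (x ≟ i) then 1 else 0

δ-diag : ∀ x → δ x x ≡ 1
δ-diag x rewrite dec-true (x ≟ x) refl = refl

δ-off : ∀ {x i} → x ≢ i → δ x i ≡ 0
δ-off {x} {i} x≢i rewrite dec-false (x ≟ i) x≢i = refl

module _ {A : Set} {p} {P : Pred A p} (P? : Decidable P) where

  sum-filter-tabulate : ∀ {n} (f : Fin n → A) (w : A → ℕ) →
    sum (map w (filter P? (tabulate f))) ≡ ∑[ j < n ] (if does (P? (f j)) then w (f j) else 0)
  sum-filter-tabulate {zero}  f w = refl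
  sum-filter-tabulate {suc n} f w with does (P? (f zero))
  ... | true  = cong (w (f zero) +_) (sum-filter-tabulate (f ∘ suc) w)
  ... | false = sum-filter-tabulate (f ∘ suc) w

  length-filter-tabulate : ∀ {n} (f : Fin n → A) →
    length (filter P? (tabulate f)) ≡ ∑[ j < n ] (if does (P? (f j)) then 1 else 0)
  length-filter-tabulate {zero}  f = refl
  length-filter-tabulate {suc n} f with does (P? (f zero))
  ... | true  = cong suc (length-filter-tabulate (f ∘ suc))
  ... | false = length-filter-tabulate (f ∘ suc)

countEq-∑ : ∀ {n} (f : Fin n → ℕ) i → countEq f i ≡ ∑[ j < n ] δ (f j) i
countEq-∑ f i = length-filter-tabulate (λ j → f j ≟ i) (λ j → j)

sumFrom2-cong : ∀ {M M′ : ℕ → ℕ} → (∀ i → M i ≡ M′ i) → ∀ B → sumFrom2 M B ≡ sumFrom2 M′ B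
sumFrom2-cong M≗M′ zero          = refl
sumFrom2-cong M≗M′ (suc zero)    = refl
sumFrom2-cong M≗M′ (suc (suc B)) =
  cong₂ _+_ (sumFrom2-cong M≗M′ (suc B)) (cong (suc (suc B) *_) (M≗M′ (suc (suc B))))

sumFrom2-vanishes : ∀ {M : ℕ → ℕ} B → (∀ i → 2 ≤ i → i ≤ B → M i ≡ 0) → sumFrom2 M B ≡ 0
sumFrom2-vanishes zero          _ = refl
sumFrom2-vanishes (suc zero)    _ = refl
sumFrom2-vanishes {M} (suc (suc B)) M≡0 = begin
  sumFrom2 M (suc B) + suc (suc B) * M (suc (suc B))
    ≡⟨ cong₂ _+_ (sumFrom2-vanishes (suc B) (λ i 2≤i i≤1+B → M≡0 i 2≤i (m≤n⇒m≤1+n i≤1+B)))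
                 (cong (suc (suc B) *_) (M≡0 (suc (suc B)) (s≤s (s≤s z≤n)) ≤-refl)) ⟩
  0 + suc (suc B) * 0
    ≡⟨ *-zeroʳ (suc (suc B)) ⟩
  0 ∎
  where open ≡-Reasoning

sumFrom2-δ : ∀ {x} B → 2 ≤ x → x ≤ suc B → sumFrom2 (δ x) (suc B) ≡ x
sumFrom2-δ zero (s≤s (s≤s _)) (s≤s ())
sumFrom2-δ {x} (suc B) 2≤x x≤2+B with m≤n⇒m<n∨m≡n x≤2+B
... | inj₁ x<2+B = begin
  sumFrom2 (δ x) (suc B) + suc (suc B) * δ x (suc (suc B))
    ≡⟨ cong₂ _+_ (sumFrom2-δ B 2≤x (≤-pred x<2+B)) (cong (suc (suc B) *_) (δ-off (<⇒≢ x<2+B))) ⟩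
  x + suc (suc B) * 0
    ≡⟨ cong (x +_) (*-zeroʳ (suc (suc B))) ⟩
  x + 0
    ≡⟨ +-identityʳ x ⟩
  x ∎
  where open ≡-Reasoning
... | inj₂ refl = begin
  sumFrom2 (δ x) (suc B) + x * δ x x
    ≡⟨ cong₂ _+_ (sumFrom2-vanishes (suc B) (λ i _ i≤1+B → δ-off (>⇒≢ (s≤s i≤1+B))))
                 (cong (x *_) (δ-diag x)) ⟩
  0 + x * 1
    ≡⟨ *-identityʳ x ⟩
  x ∎
  where open ≡-Reasoning

δ-decomposition : ∀ {x} B → 1 ≤ x → x ≤ B → δ x 1 + sumFrom2 (δ x) B ≡ x
δ-decomposition {suc zero}    B       _ _     = cong suc (sumFrom2-vanishes B (λ i 2≤i _ → δ-off (<⇒≢ 2≤i)))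
δ-decomposition {suc (suc _)} (suc B) _ x≤1+B = sumFrom2-δ B (s≤s (s≤s z≤n)) x≤1+B

sumFrom2-∑ : ∀ {n} (M : Fin n → ℕ → ℕ) B →
  sumFrom2 (λ i → ∑[ j < n ] M j i) B ≡ ∑[ j < n ] sumFrom2 (M j) B
sumFrom2-∑ {n} M zero          = sym (sum-replicate-zero n)
sumFrom2-∑ {n} M (suc zero)    = sym (sum-replicate-zero n)
sumFrom2-∑ {n} M (suc (suc B)) = begin
  sumFrom2 (λ i → ∑[ j < n ] M j i) (suc B) + suc (suc B) * ∑[ j < n ] M j (suc (suc B))
    ≡⟨ cong₂ _+_ (sumFrom2-∑ M (suc B)) (*-distribˡ-sum (suc (suc B)) (λ j → M j (suc (suc B)))) ⟩
  ∑[ j < n ] sumFrom2 (M j) (suc B) + ∑[ j < n ] (suc (suc B) * M j (suc (suc B)))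
    ≡⟨ sym (∑-distrib-+ (λ j → sumFrom2 (M j) (suc B)) (λ j → suc (suc B) * M j (suc (suc B)))) ⟩
  ∑[ j < n ] sumFrom2 (M j) (suc (suc B))
    ∎
  where open ≡-Reasoning

∑-by-values : ∀ {n} (f : Fin n → ℕ) B → (∀ j → 1 ≤ f j) → (∀ j → f j ≤ B) →
  ∑[ j < n ] f j ≡ countEq f 1 + sumFrom2 (countEq f) B
∑-by-values {n} f B 1≤f f≤B = begin
  ∑[ j < n ] f j
    ≡⟨ sum-cong-≗ (λ j → sym (δ-decomposition B (1≤f j) (f≤B j))) ⟩
  ∑[ j < n ] (δ (f j) 1 + sumFrom2 (δ (f j)) B)
    ≡⟨ ∑-distrib-+ (λ j → δ (f j) 1) (λ j → sumFrom2 (δ (f j)) B) ⟩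
  ∑[ j < n ] δ (f j) 1 + ∑[ j < n ] sumFrom2 (δ (f j)) B
    ≡⟨ cong₂ _+_ (sym (countEq-∑ f 1)) (sym (sumFrom2-∑ (δ ∘ f) B)) ⟩
  countEq f 1 + sumFrom2 (λ i → ∑[ j < n ] δ (f j) i) B
    ≡⟨ cong (countEq f 1 +_) (sumFrom2-cong (λ i → sym (countEq-∑ f i)) B) ⟩
  countEq f 1 + sumFrom2 (countEq f) B
    ∎
  where open ≡-Reasoning

-- Enumerations of equivalence classes

-- Enumeration _≈_ n says that _≈_ is the kernel of a split surjection A → Fin n,
-- i.e. that A has exactly n classes.
record Enumeration {A : Set} (_≈_ : A → A → Set) (n : ℕ) : Set where
  field
    element        : Fin n → A
    index          : A → Fin n
    index-element  : ∀ i → index (element i) ≡ i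
    index-cong     : ∀ {a b} → a ≈ b → index a ≡ index b
    index-reflects : ∀ {a b} → index a ≡ index b → a ≈ b

open Enumeration

module _ {A B : Set} {_≈_ : A → A → Set} {_∼_ : B → B → Set} where

  enumeration-≤ : ∀ {n m} → Enumeration _≈_ n → Enumeration _∼_ m →
    (f : A → B) → (∀ a a′ → f a ∼ f a′ → a ≈ a′) → n ≤ m
  enumeration-≤ EA EB f f-reflects = injective⇒≤ λ {i} {j} eq → begin
    i                       ≡⟨ index-element EA i ⟨
    index EA (element EA i) ≡⟨ index-cong EA (f-reflects _ _ (index-reflects EB eq)) ⟩
    index EA (element EA j) ≡⟨ index-element EA j ⟩
    j                       ∎
    where open ≡-Reasoning

  enumeration-pullback : ∀ {n} → Enumeration _≈_ n → (g : B → A) →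
    (∀ b b′ → b ∼ b′ → g b ≈ g b′) → (∀ b b′ → g b ≈ g b′ → b ∼ b′) →
    (∀ a → Σ B λ b → g b ≈ a) → Enumeration _∼_ n
  enumeration-pullback EA g g-cong g-reflects g-onto = record
    { element        = proj₁ ∘ g-onto ∘ element EA
    ; index          = index EA ∘ g
    ; index-element  = λ i → trans (index-cong EA (proj₂ (g-onto (element EA i)))) (index-element EA i)
    ; index-cong     = index-cong EA ∘ g-cong _ _
    ; index-reflects = g-reflects _ _ ∘ index-reflects EA
    }

  enumeration-× : ∀ {n m} → Enumeration _≈_ n → Enumeration _∼_ m →
    Enumeration (Pointwise _≈_ _∼_) (n * m)
  enumeration-× {n} {m} EA EB = record
    { element        = λ i → let (k , l) = remQuot {n} m i in element EA k , element EB l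
    ; index          = λ (a , b) → combine (index EA a) (index EB b)
    ; index-element  = λ i → trans (cong₂ combine (index-element EA _) (index-element EB _))
                                   (combine-remQuot {n} m i)
    ; index-cong     = λ (a≈a′ , b∼b′) → cong₂ combine (index-cong EA a≈a′) (index-cong EB b∼b′)
    ; index-reflects = λ {(a , b)} {(a′ , b′)} eq →
        let (eqA , eqB) = combine-injective (index EA a) (index EB b) (index EA a′) (index EB b′) eq
        in index-reflects EA eqA , index-reflects EB eqB
    }

Fin-enumeration : ∀ n → Enumeration (_≡_ {A = Fin n}) n
Fin-enumeration n = record
  { element = λ i → i ; index = λ i → i ; index-element = λ _ → refl
  ; index-cong = λ eq → eq ; index-reflects = λ eq → eq }

flatten : ∀ {a} (n : Fin a → ℕ) → Σ (Fin a) (Fin ∘ n) → Fin (∑[ j < a ] n j)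
flatten n (zero  , k) = k ↑ˡ _
flatten n (suc j , k) = n zero ↑ʳ flatten (n ∘ suc) (j , k)

unflatten : ∀ {a} (n : Fin a → ℕ) → Fin (∑[ j < a ] n j) → Σ (Fin a) (Fin ∘ n)
unflatten {suc a} n i with splitAt (n zero) i
... | inj₁ k  = zero , k
... | inj₂ i′ = let (j , k) = unflatten (n ∘ suc) i′ in suc j , k

unflatten-flatten : ∀ {a} (n : Fin a → ℕ) p → unflatten n (flatten n p) ≡ p
unflatten-flatten n (zero  , k) rewrite splitAt-↑ˡ (n zero) k (∑[ j < _ ] n (suc j)) = refl
unflatten-flatten n (suc j , k) rewrite splitAt-↑ʳ (n zero) (∑[ j < _ ] n (suc j)) (flatten (n ∘ suc) (j , k))
                                      | unflatten-flatten (n ∘ suc) (j , k) = refl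

flatten-unflatten : ∀ {a} (n : Fin a → ℕ) i → flatten n (unflatten n i) ≡ i
flatten-unflatten {suc a} n i with splitAt (n zero) i in eq
... | inj₁ k  = trans (cong (Fin.join (n zero) _) (sym eq)) (join-splitAt (n zero) _ i)
... | inj₂ i′ = trans (cong (n zero ↑ʳ_) (flatten-unflatten (n ∘ suc) i′))
                      (trans (cong (Fin.join (n zero) _) (sym eq)) (join-splitAt (n zero) _ i))

flatten-injective : ∀ {a} (n : Fin a → ℕ) {p q} → flatten n p ≡ flatten n q → p ≡ q
flatten-injective n {p} {q} eq = begin
  p                         ≡⟨ unflatten-flatten n p ⟨
  unflatten n (flatten n p) ≡⟨ cong (unflatten n) eq ⟩
  unflatten n (flatten n q) ≡⟨ unflatten-flatten n q ⟩
  q                         ∎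
  where open ≡-Reasoning

Σ-Rel : {I : Set} {B : I → Set} → (∀ i → B i → B i → Set) → Σ I B → Σ I B → Set
Σ-Rel {B = B} R (i , x) (i′ , x′) = Σ (i ≡ i′) λ i≡i′ → R i′ (subst B i≡i′ x) x′

enumeration-Σ : ∀ {a} {B : Fin a → Set} {R : ∀ j → B j → B j → Set} (n : Fin a → ℕ) →
  (∀ j → Enumeration (R j) (n j)) → Enumeration (Σ-Rel R) (∑[ j < a ] n j)
enumeration-Σ {B = B} {R} n E = record
  { element        = λ i → let (j , k) = unflatten n i in j , element (E j) k
  ; index          = λ (j , x) → flatten n (j , index (E j) x)
  ; index-element  = λ i → trans (cong (λ k → flatten n (proj₁ (unflatten n i) , k)) (index-element (E _) _))
                                 (flatten-unflatten n i)
  ; index-cong     = λ { {j , _} (refl , x≈x′) → cong (λ k → flatten n (j , k)) (index-cong (E j) x≈x′) }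
  ; index-reflects = λ eq → reflects (Σ-≡,≡←≡ (flatten-injective n eq))
  }
  where
  reflects : ∀ {j j′ x x′} → Σ (j ≡ j′) (λ j≡j′ → subst (Fin ∘ n) j≡j′ (index (E j) x) ≡ index (E j′) x′) →
             Σ-Rel R (j , x) (j′ , x′)
  reflects (refl , eq) = refl , index-reflects (E _) eq

classList-enumeration : ∀ {A : Set} {R : A → A → Set} {L : List A} → IsEquivalence R →
  IsClassList R L → Enumeration R (length L)
classList-enumeration {R = R} {L} R-equiv (covers , distinct) = record
  { element        = lookup L
  ; index          = λ x → proj₁ (covers x)
  ; index-element  = λ i → sym (distinct i _ (proj₂ (covers (lookup L i))))
  ; index-cong     = λ {x} {y} x≈y →
      distinct _ _ (R-trans (R-sym (proj₂ (covers x))) (R-trans x≈y (proj₂ (covers y))))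
  ; index-reflects = λ {x} {y} eq →
      R-trans (proj₂ (covers x)) (R-sym (subst (λ i → R y (lookup L i)) (sym eq) (proj₂ (covers y))))
  }
  where open IsEquivalence R-equiv renaming (sym to R-sym; trans to R-trans)

-- Multiplicities

_≢?_ : (k x : ℕ) → Dec (k ≢ x)
k ≢? x = ¬? (k ≟ x)

mult-∷-≡ : ∀ k {x} xs → k ≡ x → mult k (x ∷ xs) ≡ suc (mult k xs)
mult-∷-≡ k _ k≡x = cong length (filter-accept (k ≟_) k≡x)

mult-∷-≢ : ∀ k {x} xs → k ≢ x → mult k (x ∷ xs) ≡ mult k xs
mult-∷-≢ k _ k≢x = cong length (filter-reject (k ≟_) k≢x)

module _ {p} {P : Pred ℕ p} (P? : Decidable P) where

  mult-filter-∷-≢ : ∀ {k y} D → k ≢ y → mult k (filter P? (y ∷ D)) ≡ mult k (filter P? D)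
  mult-filter-∷-≢ {y = y} D k≢y with P? y
  ... | yes _ = mult-∷-≢ _ _ k≢y
  ... | no _  = refl

  mult-filter-accept : ∀ {k} → P k → ∀ D → mult k (filter P? D) ≡ mult k D
  mult-filter-accept     Pk []      = refl
  mult-filter-accept {k} Pk (y ∷ D) with k ≟ y
  ... | yes refl = begin
    mult k (filter P? (k ∷ D)) ≡⟨ cong (mult k) (filter-accept P? Pk) ⟩
    mult k (k ∷ filter P? D)   ≡⟨ mult-∷-≡ k (filter P? D) refl ⟩
    suc (mult k (filter P? D)) ≡⟨ cong suc (mult-filter-accept Pk D) ⟩
    suc (mult k D)             ≡⟨ mult-∷-≡ k D refl ⟨
    mult k (k ∷ D)             ∎
    where open ≡-Reasoning
  ... | no k≢y = trans (mult-filter-∷-≢ D k≢y) (trans (mult-filter-accept Pk D) (sym (mult-∷-≢ k D k≢y)))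

  mult-filter-reject : ∀ {k} → ¬ P k → ∀ D → mult k (filter P? D) ≡ 0
  mult-filter-reject     ¬Pk []      = refl
  mult-filter-reject {k} ¬Pk (y ∷ D) with k ≟ y
  ... | yes refl = trans (cong (mult k) (filter-reject P? ¬Pk)) (mult-filter-reject ¬Pk D)
  ... | no k≢y   = trans (mult-filter-∷-≢ D k≢y) (mult-filter-reject ¬Pk D)

mult-deduplicate : ∀ k xs → mult k (deduplicate _≟_ xs) ≡ 1 ⊓ mult k xs
mult-deduplicate k []       = refl
mult-deduplicate k (x ∷ xs) with k ≟ x
... | yes refl = begin
  mult k (k ∷ filter (k ≢?_) D)    ≡⟨ mult-∷-≡ k (filter (k ≢?_) D) refl ⟩
  suc (mult k (filter (k ≢?_) D))  ≡⟨ cong suc (mult-filter-reject (k ≢?_) (λ k≢k → k≢k refl) D) ⟩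
  1                                ≡⟨ cong (1 ⊓_) (mult-∷-≡ k xs refl) ⟨
  1 ⊓ mult k (k ∷ xs)              ∎
  where
  open ≡-Reasoning
  D = deduplicate _≟_ xs
... | no k≢x = begin
  mult k (x ∷ filter (x ≢?_) D)    ≡⟨ mult-∷-≢ k (filter (x ≢?_) D) k≢x ⟩
  mult k (filter (x ≢?_) D)        ≡⟨ mult-filter-accept (x ≢?_) (k≢x ∘ sym) D ⟩
  mult k D                         ≡⟨ mult-deduplicate k xs ⟩
  1 ⊓ mult k xs                    ≡⟨ cong (1 ⊓_) (mult-∷-≢ k xs k≢x) ⟨
  1 ⊓ mult k (x ∷ xs)              ∎
  where
  open ≡-Reasoning
  D = deduplicate _≟_ xs

module _ (g : ℕ → ℕ) where

  private
    ∏ : List ℕ → ℕ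
    ∏ D = product (map g D)

  product-split-filter : ∀ {p} {P : Pred ℕ p} (P? : Decidable P) D →
    ∏ D ≡ ∏ (filter P? D) * ∏ (filter (¬? ∘ P?) D)
  product-split-filter P? []      = refl
  product-split-filter P? (x ∷ D) with P? x
  ... | yes _ = trans (cong (g x *_) (product-split-filter P? D))
                      (sym (*-assoc (g x) (∏ (filter P? D)) (∏ (filter (¬? ∘ P?) D))))
  ... | no _  = trans (cong (g x *_) (product-split-filter P? D))
                      (x∙yz≈y∙xz (g x) (∏ (filter P? D)) (∏ (filter (¬? ∘ P?) D)))

  product-filter-≟ : ∀ k D → ∏ (filter (k ≟_) D) ≡ g k ^ mult k D
  product-filter-≟ k []      = refl
  product-filter-≟ k (x ∷ D) with k ≟ x
  ... | yes k≡x = begin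
    ∏ (filter (k ≟_) (x ∷ D))       ≡⟨ cong ∏ (filter-accept (k ≟_) k≡x) ⟩
    g x * ∏ (filter (k ≟_) D)       ≡⟨ cong₂ _*_ (cong g (sym k≡x)) (product-filter-≟ k D) ⟩
    g k ^ suc (mult k D)            ≡⟨ cong (g k ^_) (mult-∷-≡ k D k≡x) ⟨
    g k ^ mult k (x ∷ D)            ∎
    where open ≡-Reasoning
  ... | no k≢x = begin
    ∏ (filter (k ≟_) (x ∷ D))       ≡⟨ cong ∏ (filter-reject (k ≟_) k≢x) ⟩
    ∏ (filter (k ≟_) D)             ≡⟨ product-filter-≟ k D ⟩
    g k ^ mult k D                  ≡⟨ cong (g k ^_) (mult-∷-≢ k D k≢x) ⟨
    g k ^ mult k (x ∷ D)            ∎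
    where open ≡-Reasoning

  product-deduplicate : ∀ k xs → (mult k xs ≡ 0 → g k ≡ 1) →
    ∏ (deduplicate _≟_ xs) ≡ g k * ∏ (filter (k ≢?_) (deduplicate _≟_ xs))
  product-deduplicate k xs absent⇒1 = begin
    ∏ D                         ≡⟨ product-split-filter (k ≟_) D ⟩
    ∏ (filter (k ≟_) D) * R     ≡⟨ cong (_* R) (product-filter-≟ k D) ⟩
    g k ^ mult k D * R          ≡⟨ cong (λ m → g k ^ m * R) (mult-deduplicate k xs) ⟩
    g k ^ (1 ⊓ mult k xs) * R   ≡⟨ cong (_* R) (^-1⊓ (mult k xs) absent⇒1) ⟩
    g k * R                     ∎
    where
    open ≡-Reasoning
    D = deduplicate _≟_ xs
    R = ∏ (filter (k ≢?_) D)
    ^-1⊓ : ∀ m → (m ≡ 0 → g k ≡ 1) → g k ^ (1 ⊓ m) ≡ g k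
    ^-1⊓ zero    absent⇒1 = sym (absent⇒1 refl)
    ^-1⊓ (suc m) _        = *-identityʳ (g k)

multFact-∷ : ∀ k ks → multFact (k ∷ ks) ≡ mult k (k ∷ ks) * multFact ks
multFact-∷ k ks = begin
  mult k (k ∷ ks) ! * product (map (λ v → mult v (k ∷ ks) !) (filter (k ≢?_) D))
    ≡⟨ cong₂ _*_ (cong _! (mult-∷-≡ k ks refl)) (cong product (map-cong-local mult-unchanged)) ⟩
  (suc m * m !) * product (map (λ v → mult v ks !) (filter (k ≢?_) D))
    ≡⟨ *-assoc (suc m) (m !) _ ⟩
  suc m * (m ! * product (map (λ v → mult v ks !) (filter (k ≢?_) D)))
    ≡⟨ cong (suc m *_) (product-deduplicate (λ v → mult v ks !) k ks (cong _!)) ⟨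
  suc m * multFact ks
    ≡⟨ cong (_* multFact ks) (mult-∷-≡ k ks refl) ⟨
  mult k (k ∷ ks) * multFact ks
    ∎
  where
  open ≡-Reasoning
  D = deduplicate _≟_ ks
  m = mult k ks
  mult-unchanged : All.All (λ v → mult v (k ∷ ks) ! ≡ mult v ks !) (filter (k ≢?_) D)
  mult-unchanged = All.map (λ k≢v → cong _! (mult-∷-≢ _ ks (k≢v ∘ sym))) (all-filter (k ≢?_) D)

-- Weight-preserving permutations

Positions : List ℕ → ℕ → Set
Positions xs k = Σ (Fin (length xs)) (λ j → lookup xs j ≡ k)

_≈ᵖ_ : ∀ {xs k} → Positions xs k → Positions xs k → Set
_≈ᵖ_ = _≡_ on proj₁

there : ∀ {x xs k} → Positions xs k → Positions (x ∷ xs) k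
there (j , xs[j]≡k) = suc j , xs[j]≡k

positions-enumeration : ∀ xs k → Enumeration (_≈ᵖ_ {xs} {k}) (mult k xs)
positions-enumeration []       k = record
  { element = λ () ; index = λ { (() , _) } ; index-element = λ ()
  ; index-cong = λ { {() , _} } ; index-reflects = λ { {() , _} } }
positions-enumeration (x ∷ xs) k with k ≟ x
... | yes k≡x = subst (Enumeration (_≈ᵖ_ {x ∷ xs} {k})) (sym (mult-∷-≡ k xs k≡x)) (record
  { element        = λ { zero → zero , sym k≡x ; (suc i) → there (element E i) }
  ; index          = λ { (zero , _) → zero ; (suc j , xs[j]≡k) → suc (index E (j , xs[j]≡k)) }
  ; index-element  = λ { zero → refl ; (suc i) → cong suc (index-element E i) }
  ; index-cong     = λ { {zero , _} refl → refl ; {suc _ , _} refl → cong suc (index-cong E refl) }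
  ; index-reflects = λ { {zero , _} {zero , _} _ → refl
                       ; {zero , _} {suc _ , _} ()
                       ; {suc _ , _} {zero , _} ()
                       ; {suc _ , _} {suc _ , _} eq → cong suc (index-reflects E (suc-injective eq)) }
  })
  where E = positions-enumeration xs k
... | no k≢x = subst (Enumeration (_≈ᵖ_ {x ∷ xs} {k})) (sym (mult-∷-≢ k xs k≢x)) (record
  { element        = there ∘ element E
  ; index          = λ { (zero , x≡k) → contradiction (sym x≡k) k≢x
                       ; (suc j , xs[j]≡k) → index E (j , xs[j]≡k) }
  ; index-element  = index-element E
  ; index-cong     = λ { {zero , x≡k} refl → contradiction (sym x≡k) k≢x
                       ; {suc _ , _} refl → index-cong E refl }
  ; index-reflects = λ { {zero , x≡k} _ → contradiction (sym x≡k) k≢x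
                       ; {suc _ , _} {zero , x≡k} _ → contradiction (sym x≡k) k≢x
                       ; {suc _ , _} {suc _ , _} eq → cong suc (index-reflects E eq) }
  })
  where E = positions-enumeration xs k

transpose-preserves : ∀ {n} {A : Set} (c : Fin n → A) {i j} → c i ≡ c j → ∀ x → c (PC.transpose i j x) ≡ c x
transpose-preserves c {i} {j} ci≡cj x with x Fin.≟ i
... | yes refl = sym ci≡cj
... | no _ with x Fin.≟ j
...   | yes refl = ci≡cj
...   | no _     = refl

transpose-right : ∀ {n} (i j : Fin n) → PC.transpose i j j ≡ i
transpose-right i j with j Fin.≟ i
... | yes j≡i = j≡i
... | no _ rewrite dec-true (j Fin.≟ j) refl = refl

WeightPreserving : (xs : List ℕ) → Permutation′ (length xs) → Set
WeightPreserving xs π = ∀ v → lookup xs (π ⟨$⟩ʳ v) ≡ lookup xs v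

record WeightPerm (xs : List ℕ) : Set where
  constructor ⟨_,_⟩
  field
    perm      : Permutation′ (length xs)
    preserves : WeightPreserving xs perm

open WeightPerm using (perm)

_≈ₚ_ : ∀ {xs} → WeightPerm xs → WeightPerm xs → Set
⟨ π , _ ⟩ ≈ₚ ⟨ π′ , _ ⟩ = ∀ v → π ⟨$⟩ʳ v ≡ π′ ⟨$⟩ʳ v

-- A weight-preserving permutation π of k ∷ ks is determined by the position π 0, which has weight k,
-- and by the weight-preserving permutation of ks left over once π is followed by the transposition
-- of 0 and π 0.
module _ (k : ℕ) (ks : List ℕ) where

  private
    c : Fin (length (k ∷ ks)) → ℕ
    c = lookup (k ∷ ks)

    fixZero : Permutation′ (length (k ∷ ks)) → Permutation′ (length (k ∷ ks))
    fixZero π = π ∘ₚ Perm.transpose zero (π ⟨$⟩ʳ zero)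

    fixZero-zero : ∀ π → fixZero π ⟨$⟩ʳ zero ≡ zero
    fixZero-zero π = transpose-right zero (π ⟨$⟩ʳ zero)

    suc-remove : ∀ π y → suc (remove zero (fixZero π) ⟨$⟩ʳ y) ≡ fixZero π ⟨$⟩ʳ suc y
    suc-remove π y = lift₀-remove (fixZero π) (fixZero-zero π) (suc y)

  weightPerm-cons : Positions (k ∷ ks) k × WeightPerm ks → WeightPerm (k ∷ ks)
  weightPerm-cons ((j , c[j]≡k) , ⟨ π , π-wp ⟩) = ⟨ lift₀ π ∘ₚ Perm.transpose j zero , (λ v →
    trans (transpose-preserves c c[j]≡k (lift₀ π ⟨$⟩ʳ v)) (lift₀-wp v)) ⟩
    where
    lift₀-wp : WeightPreserving (k ∷ ks) (lift₀ π)
    lift₀-wp zero    = refl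
    lift₀-wp (suc y) = π-wp y

  weightPerm-uncons : WeightPerm (k ∷ ks) → Positions (k ∷ ks) k × WeightPerm ks
  weightPerm-uncons ⟨ π , π-wp ⟩ = (π ⟨$⟩ʳ zero , π-wp zero) , ⟨ remove zero (fixZero π) , (λ y → begin
    c (suc (remove zero (fixZero π) ⟨$⟩ʳ y)) ≡⟨ cong c (suc-remove π y) ⟩
    c (fixZero π ⟨$⟩ʳ suc y)                 ≡⟨ transpose-preserves c (sym (π-wp zero)) (π ⟨$⟩ʳ suc y) ⟩
    c (π ⟨$⟩ʳ suc y)                         ≡⟨ π-wp (suc y) ⟩
    c (suc y)                                ∎) ⟩
    where open ≡-Reasoning

  _≈_ : (a a′ : Positions (k ∷ ks) k × WeightPerm ks) → Set
  _≈_ = Pointwise _≈ᵖ_ _≈ₚ_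

  weightPerm-cons-cong : ∀ a a′ → a ≈ a′ → weightPerm-cons a ≈ₚ weightPerm-cons a′
  weightPerm-cons-cong ((j , _) , ⟨ π , _ ⟩) (_ , ⟨ π′ , _ ⟩) (refl , π≈π′) v =
    cong (PC.transpose j zero) (lift₀-cong π π′ π≈π′ v)

  weightPerm-uncons-cong : ∀ π π′ → π ≈ₚ π′ → weightPerm-uncons π ≈ weightPerm-uncons π′
  weightPerm-uncons-cong ⟨ π , _ ⟩ ⟨ π′ , _ ⟩ π≈π′ = π≈π′ zero , λ y → suc-injective (begin
    suc (remove zero (fixZero π) ⟨$⟩ʳ y)  ≡⟨ suc-remove π y ⟩
    fixZero π ⟨$⟩ʳ suc y                  ≡⟨ cong₂ (PC.transpose zero) (π≈π′ zero) (π≈π′ (suc y)) ⟩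
    fixZero π′ ⟨$⟩ʳ suc y                 ≡⟨ suc-remove π′ y ⟨
    suc (remove zero (fixZero π′) ⟨$⟩ʳ y) ∎)
    where open ≡-Reasoning

  weightPerm-uncons-cons : ∀ a → weightPerm-uncons (weightPerm-cons a) ≈ a
  weightPerm-uncons-cons ((j , _) , ⟨ π , _ ⟩) = transpose-right j zero , λ y → suc-injective (begin
    suc (remove zero (fixZero σ) ⟨$⟩ʳ y)
      ≡⟨ suc-remove σ y ⟩
    PC.transpose zero (σ ⟨$⟩ʳ zero) (σ ⟨$⟩ʳ suc y)
      ≡⟨ cong (λ i → PC.transpose zero i (σ ⟨$⟩ʳ suc y)) (transpose-right j zero) ⟩
    PC.transpose zero j (PC.transpose j zero (suc (π ⟨$⟩ʳ y)))
      ≡⟨ PC.transpose-inverse zero j ⟩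
    suc (π ⟨$⟩ʳ y) ∎)
    where
    open ≡-Reasoning
    σ = lift₀ π ∘ₚ Perm.transpose j zero

  weightPerm-cons-uncons : ∀ π → weightPerm-cons (weightPerm-uncons π) ≈ₚ π
  weightPerm-cons-uncons ⟨ π , _ ⟩ v = begin
    PC.transpose (π ⟨$⟩ʳ zero) zero (lift₀ (remove zero (fixZero π)) ⟨$⟩ʳ v)
      ≡⟨ cong (PC.transpose (π ⟨$⟩ʳ zero) zero) (lift₀-remove (fixZero π) (fixZero-zero π) v) ⟩
    PC.transpose (π ⟨$⟩ʳ zero) zero (PC.transpose zero (π ⟨$⟩ʳ zero) (π ⟨$⟩ʳ v))
      ≡⟨ PC.transpose-inverse (π ⟨$⟩ʳ zero) zero ⟩
    π ⟨$⟩ʳ v ∎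
    where open ≡-Reasoning

  weightPerm-uncons-reflects : ∀ π π′ → weightPerm-uncons π ≈ weightPerm-uncons π′ → π ≈ₚ π′
  weightPerm-uncons-reflects π π′ eq v = begin
    perm π ⟨$⟩ʳ v
      ≡⟨ weightPerm-cons-uncons π v ⟨
    perm (weightPerm-cons (weightPerm-uncons π)) ⟨$⟩ʳ v
      ≡⟨ weightPerm-cons-cong (weightPerm-uncons π) (weightPerm-uncons π′) eq v ⟩
    perm (weightPerm-cons (weightPerm-uncons π′)) ⟨$⟩ʳ v
      ≡⟨ weightPerm-cons-uncons π′ v ⟩
    perm π′ ⟨$⟩ʳ v ∎
    where open ≡-Reasoning

weightPerm-enumeration : ∀ xs → Enumeration (_≈ₚ_ {xs}) (multFact xs)
weightPerm-enumeration []       = record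
  { element = λ _ → ⟨ Perm.id , (λ ()) ⟩ ; index = λ _ → zero ; index-element = λ { zero → refl }
  ; index-cong = λ _ → refl ; index-reflects = λ _ () }
weightPerm-enumeration (k ∷ ks) = subst (Enumeration _≈ₚ_) (sym (multFact-∷ k ks))
  (enumeration-pullback (enumeration-× (positions-enumeration (k ∷ ks) k) (weightPerm-enumeration ks))
    (weightPerm-uncons k ks) (weightPerm-uncons-cong k ks) (weightPerm-uncons-reflects k ks)
    (λ a → weightPerm-cons k ks a , weightPerm-uncons-cons k ks a))

-- Trees have no parallel edges

least : {P : ℕ → Set} → (∀ k → Dec (P k)) → ℕ → ℕ
least P? zero    = zero
least P? (suc n) with P? zero
... | yes _ = zero
... | no _  = suc (least (P? ∘ suc) n)

least-satisfies : ∀ {P : ℕ → Set} (P? : ∀ k → Dec (P k)) n → P n → P (least P? n)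
least-satisfies P? zero    Pn = Pn
least-satisfies P? (suc n) Pn with P? zero
... | yes P0 = P0
... | no _   = least-satisfies (P? ∘ suc) n Pn

least-minimal : ∀ {P : ℕ → Set} (P? : ∀ k → Dec (P k)) n k → P k → least P? n ≤ k
least-minimal P? zero    k       _  = z≤n
least-minimal P? (suc n) k       Pk with P? zero
... | yes _ = z≤n
least-minimal P? (suc n) zero    Pk | no ¬P0 = contradiction Pk ¬P0
least-minimal P? (suc n) (suc k) Pk | no _   = s≤s (least-minimal (P? ∘ suc) n k Pk)

module _ {a b E : ℕ} (wv : Fin E → Fin a) (bv : Fin E → Fin b) where

  private
    _≟ᵥ_ : (x y : Fin a ⊎ Fin b) → Dec (x ≡ y)
    _≟ᵥ_ = ≡-dec Fin._≟_ Fin._≟_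

  Within : Fin a ⊎ Fin b → ℕ → Fin a ⊎ Fin b → Set
  Within r zero    x = x ≡ r
  Within r (suc k) x = Within r k x ⊎ Σ (Fin E) λ ε →
    (x ≡ inj₁ (wv ε) × Within r k (inj₂ (bv ε))) ⊎ (x ≡ inj₂ (bv ε) × Within r k (inj₁ (wv ε)))

  within? : ∀ r k x → Dec (Within r k x)
  within? r zero    x = x ≟ᵥ r
  within? r (suc k) x = within? r k x ⊎-dec any? λ ε →
    ((x ≟ᵥ inj₁ (wv ε)) ×-dec within? r k (inj₂ (bv ε)))
      ⊎-dec ((x ≟ᵥ inj₂ (bv ε)) ×-dec within? r k (inj₁ (wv ε)))

  path-length : ∀ {x y} → Reach wv bv x y → ℕ
  path-length here     = zero
  path-length (wb _ p) = suc (path-length p)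
  path-length (bw _ p) = suc (path-length p)

  path-within : ∀ {x r} (p : Reach wv bv x r) → Within r (path-length p) x
  path-within here     = refl
  path-within (wb ε p) = inj₂ (ε , inj₁ (refl , path-within p))
  path-within (bw ε p) = inj₂ (ε , inj₂ (refl , path-within p))

module SpanningTree {a b E : ℕ} (wv : Fin E → Fin a) (bv : Fin E → Fin b)
  (connected : ∀ x y → Reach wv bv x y) (r : Fin a ⊎ Fin b) where

  depth : Fin a ⊎ Fin b → ℕ
  depth x = least (λ k → within? wv bv r k x) (path-length wv bv (connected x r))

  depth-within : ∀ x → Within wv bv r (depth x) x
  depth-within x = least-satisfies (λ k → within? wv bv r k x) (path-length wv bv (connected x r))
                                   (path-within wv bv (connected x r))

  depth-minimal : ∀ x k → Within wv bv r k x → depth x ≤ k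
  depth-minimal x = least-minimal (λ k → within? wv bv r k x) (path-length wv bv (connected x r))

  ParentEdge : Fin a ⊎ Fin b → Fin E → Set
  ParentEdge x ε = (x ≡ inj₁ (wv ε) × depth (inj₂ (bv ε)) < depth x)
                 ⊎ (x ≡ inj₂ (bv ε) × depth (inj₁ (wv ε)) < depth x)

  parent : ∀ x → x ≡ r ⊎ Σ (Fin E) (ParentEdge x)
  parent x = descend (depth x) refl (depth-within x)
    where
    descend : ∀ k → depth x ≡ k → Within wv bv r k x → x ≡ r ⊎ Σ (Fin E) (ParentEdge x)
    descend zero    _      x≡r         = inj₁ x≡r
    descend (suc k) d≡1+k (inj₁ near) = contradiction (subst (_≤ k) d≡1+k (depth-minimal x k near)) (n≮n k)
    descend (suc k) d≡1+k (inj₂ (ε , inj₁ (x≡w , near))) =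
      inj₂ (ε , inj₁ (x≡w , subst (_ <_) (sym d≡1+k) (s≤s (depth-minimal _ k near))))
    descend (suc k) d≡1+k (inj₂ (ε , inj₂ (x≡b , near))) =
      inj₂ (ε , inj₂ (x≡b , subst (_ <_) (sym d≡1+k) (s≤s (depth-minimal _ k near))))

  parentEdge-injective : ∀ {x y ε} → ParentEdge x ε → ParentEdge y ε → x ≡ y
  parentEdge-injective (inj₁ (x≡w , _))    (inj₁ (y≡w , _))    = trans x≡w (sym y≡w)
  parentEdge-injective (inj₂ (x≡b , _))    (inj₂ (y≡b , _))    = trans x≡b (sym y≡b)
  parentEdge-injective (inj₁ (refl , b<w)) (inj₂ (refl , w<b)) = contradiction w<b (<-asym b<w)
  parentEdge-injective (inj₂ (refl , w<b)) (inj₁ (refl , b<w)) = contradiction w<b (<-asym b<w)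

  parentEdge-nonroot : ∀ {x ε} → ParentEdge x ε → x ≢ r
  parentEdge-nonroot (inj₁ (_ , lt)) refl = n≮0 (≤-trans lt (depth-minimal r 0 refl))
  parentEdge-nonroot (inj₂ (_ , lt)) refl = n≮0 (≤-trans lt (depth-minimal r 0 refl))

  parentEdgeOr : Fin E → Fin a ⊎ Fin b → Fin E
  parentEdgeOr d x with parent x
  ... | inj₁ _       = d
  ... | inj₂ (ε , _) = ε

  parentEdgeOr-spec : ∀ d x → (x ≡ r × parentEdgeOr d x ≡ d) ⊎ ParentEdge x (parentEdgeOr d x)
  parentEdgeOr-spec d x with parent x
  ... | inj₁ x≡r       = inj₁ (x≡r , refl)
  ... | inj₂ (_ , x→ε) = inj₂ x→ε

  parentEdgeOr-nonroot : ∀ d d′ {x} → x ≢ r → parentEdgeOr d x ≡ parentEdgeOr d′ x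
  parentEdgeOr-nonroot d d′ {x} x≢r with parent x
  ... | inj₁ x≡r = contradiction x≡r x≢r
  ... | inj₂ _   = refl

-- Two parallel edges e ≢ e′ would extend the parent-edge map of a spanning tree rooted at the white
-- end of e to an injection of all a + b vertices into the E = a + b − 1 edges: send the root to
-- whichever of e, e′ is not the parent edge of the black end.
no-parallel-edges : ∀ {a b E} (wv : Fin E → Fin a) (bv : Fin E → Fin b) →
  (∀ x y → Reach wv bv x y) → E + 1 ≡ a + b →
  ∀ e e′ → wv e ≡ wv e′ → bv e ≡ bv e′ → e ≡ e′
no-parallel-edges {a} {b} {E} wv bv connected edges e e′ w≡w′ b≡b′ with e Fin.≟ e′
... | yes e≡e′ = e≡e′
... | no  e≢e′ =
  ⊥-elim (n≮n E (subst (_≤ E) (trans (sym edges) (+-comm E 1)) (injective⇒≤ f∘splitAt-injective)))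
  where
  open SpanningTree wv bv connected (inj₁ (wv e))

  u : Fin a ⊎ Fin b
  u = inj₂ (bv e)

  other : Fin E
  other with parentEdgeOr e u Fin.≟ e
  ... | yes _ = e′
  ... | no _  = e

  other-≢ : other ≢ parentEdgeOr e u
  other-≢ with parentEdgeOr e u Fin.≟ e
  ... | yes pu≡e = λ e′≡pu → e≢e′ (trans (sym pu≡e) (sym e′≡pu))
  ... | no  pu≢e = λ e≡pu → pu≢e (sym e≡pu)

  other-ends : wv other ≡ wv e × bv other ≡ bv e
  other-ends with parentEdgeOr e u Fin.≟ e
  ... | yes _ = sym w≡w′ , sym b≡b′
  ... | no _  = refl , refl

  f : Fin a ⊎ Fin b → Fin E
  f = parentEdgeOr other

  child-of-other : ∀ {y} → ParentEdge y other → y ≡ u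
  child-of-other y→other@(inj₁ (y≡w , _)) =
    contradiction (trans y≡w (cong inj₁ (proj₁ other-ends))) (parentEdge-nonroot y→other)
  child-of-other (inj₂ (y≡b , _)) = trans y≡b (cong inj₂ (proj₂ other-ends))

  root-vs-child : ∀ {y} → f y ≡ other → ¬ ParentEdge y (f y)
  root-vs-child {y} fy≡other y→fy = other-≢ (begin
    other             ≡⟨ fy≡other ⟨
    f y               ≡⟨ cong f (child-of-other (subst (ParentEdge y) fy≡other y→fy)) ⟩
    f u               ≡⟨ parentEdgeOr-nonroot other e (λ ()) ⟩
    parentEdgeOr e u  ∎)
    where open ≡-Reasoning

  f-injective : ∀ {x y} → f x ≡ f y → x ≡ y
  f-injective {x} {y} fx≡fy with parentEdgeOr-spec other x | parentEdgeOr-spec other y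
  ... | inj₁ (x≡r , _)      | inj₁ (y≡r , _)      = trans x≡r (sym y≡r)
  ... | inj₁ (_ , fx≡other) | inj₂ y→fy           = ⊥-elim (root-vs-child (trans (sym fx≡fy) fx≡other) y→fy)
  ... | inj₂ x→fx           | inj₁ (_ , fy≡other) = ⊥-elim (root-vs-child (trans fx≡fy fy≡other) x→fx)
  ... | inj₂ x→fx           | inj₂ y→fy           =
    parentEdge-injective x→fx (subst (ParentEdge y) (sym fx≡fy) y→fy)

  f∘splitAt-injective : ∀ {i j} → f (splitAt a i) ≡ f (splitAt a j) → i ≡ j
  f∘splitAt-injective {i} {j} eq = begin
    i                          ≡⟨ join-splitAt a b i ⟨
    Fin.join a b (splitAt a i) ≡⟨ cong (Fin.join a b) (f-injective eq) ⟩
    Fin.join a b (splitAt a j) ≡⟨ join-splitAt a b j ⟩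
    j                          ∎
    where open ≡-Reasoning

-- Isomorphisms of w-trees

permutation-injective : ∀ {m n} (π : Permutation m n) {x y} → π ⟨$⟩ʳ x ≡ π ⟨$⟩ʳ y → x ≡ y
permutation-injective π {x} {y} eq = trans (sym (inverseˡ π)) (trans (cong (π ⟨$⟩ˡ_) eq) (inverseˡ π))

does-≟-permute : ∀ {m n} (π : Permutation m n) x y → does (π ⟨$⟩ʳ x Fin.≟ π ⟨$⟩ʳ y) ≡ does (x Fin.≟ y)
does-≟-permute π x y with x Fin.≟ y
... | yes refl = dec-true (π ⟨$⟩ʳ x Fin.≟ π ⟨$⟩ʳ x) refl
... | no  x≢y  = dec-false (π ⟨$⟩ʳ x Fin.≟ π ⟨$⟩ʳ y) (x≢y ∘ permutation-injective π)

incSum-∑ : ∀ {E m} (end : Fin E → Fin m) (w : Fin E → ℕ) v →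
  incSum end w v ≡ ∑[ e < E ] (if does (end e Fin.≟ v) then w e else 0)
incSum-∑ end w v = sum-filter-tabulate (λ e → end e Fin.≟ v) (λ e → e) w

incSum-transport : ∀ {E₁ E₂ m} (φ : Permutation E₁ E₂) (α : Permutation′ m)
  {end₁ : Fin E₁ → Fin m} {end₂ : Fin E₂ → Fin m} {w₁ : Fin E₁ → ℕ} {w₂ : Fin E₂ → ℕ} →
  (∀ e → end₂ (φ ⟨$⟩ʳ e) ≡ α ⟨$⟩ʳ end₁ e) → (∀ e → w₂ (φ ⟨$⟩ʳ e) ≡ w₁ e) →
  ∀ v → incSum end₂ w₂ (α ⟨$⟩ʳ v) ≡ incSum end₁ w₁ v
incSum-transport {E₁} {E₂} φ α {end₁} {end₂} {w₁} {w₂} φ-end φ-w v = begin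
  incSum end₂ w₂ (α ⟨$⟩ʳ v)
    ≡⟨ incSum-∑ end₂ w₂ (α ⟨$⟩ʳ v) ⟩
  ∑[ e < E₂ ] (if does (end₂ e Fin.≟ α ⟨$⟩ʳ v) then w₂ e else 0)
    ≡⟨ sum-permute (λ e → if does (end₂ e Fin.≟ α ⟨$⟩ʳ v) then w₂ e else 0) φ ⟩
  ∑[ e < E₁ ] (if does (end₂ (φ ⟨$⟩ʳ e) Fin.≟ α ⟨$⟩ʳ v) then w₂ (φ ⟨$⟩ʳ e) else 0)
    ≡⟨ sum-cong-≗ summand-≡ ⟩
  ∑[ e < E₁ ] (if does (end₁ e Fin.≟ v) then w₁ e else 0)
    ≡⟨ incSum-∑ end₁ w₁ v ⟨
  incSum end₁ w₁ v
    ∎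
  where
  open ≡-Reasoning
  summand-≡ : ∀ e → (if does (end₂ (φ ⟨$⟩ʳ e) Fin.≟ α ⟨$⟩ʳ v) then w₂ (φ ⟨$⟩ʳ e) else 0)
                  ≡ (if does (end₁ e Fin.≟ v) then w₁ e else 0)
  summand-≡ e rewrite φ-end e | φ-w e | does-≟-permute α (end₁ e) v = refl

incSum-relabel : ∀ {xs E} (π : WeightPerm xs) (end : Fin E → Fin (length xs)) (w : Fin E → ℕ) →
  (∀ v → incSum end w v ≡ lookup xs v) → ∀ v → incSum (λ e → perm π ⟨$⟩ʳ end e) w v ≡ lookup xs v
incSum-relabel {xs} ⟨ π , π-wp ⟩ end w end-wt v = begin
  incSum (λ e → π ⟨$⟩ʳ end e) w v
    ≡⟨ cong (incSum (λ e → π ⟨$⟩ʳ end e) w) (inverseʳ π) ⟨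
  incSum (λ e → π ⟨$⟩ʳ end e) w (π ⟨$⟩ʳ (π ⟨$⟩ˡ v))
    ≡⟨ incSum-transport Perm.id π {end} {λ e → π ⟨$⟩ʳ end e} {w} {w} (λ _ → refl) (λ _ → refl) (π ⟨$⟩ˡ v) ⟩
  incSum end w (π ⟨$⟩ˡ v)
    ≡⟨ end-wt (π ⟨$⟩ˡ v) ⟩
  lookup xs (π ⟨$⟩ˡ v)
    ≡⟨ π-wp (π ⟨$⟩ˡ v) ⟨
  lookup xs (π ⟨$⟩ʳ (π ⟨$⟩ˡ v))
    ≡⟨ cong (lookup xs) (inverseʳ π) ⟩
  lookup xs v ∎
  where open ≡-Reasoning

open WTree
open Iso

VertexPerm : List ℕ → List ℕ → Set
VertexPerm ks ls = WeightPerm ks × WeightPerm ls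

_≈ᵥ_ : ∀ {ks ls} → VertexPerm ks ls → VertexPerm ks ls → Set
_≈ᵥ_ = Pointwise _≈ₚ_ _≈ₚ_

module _ {ks ls : List ℕ} where

  iso-refl : (T : WTree ks ls) → Iso T T
  iso-refl T = record
    { φ = Perm.id ; α = Perm.id ; β = Perm.id
    ; φ-wv = λ _ → refl ; φ-bv = λ _ → refl ; φ-w = λ _ → refl ; φ-σ = λ _ → refl ; φ-τ = λ _ → refl }

  iso-trans : {T₁ T₂ T₃ : WTree ks ls} → Iso T₁ T₂ → Iso T₂ T₃ → Iso T₁ T₃
  iso-trans i j = record
    { φ    = φ i ∘ₚ φ j
    ; α    = α i ∘ₚ α j
    ; β    = β i ∘ₚ β j
    ; φ-wv = λ e → trans (φ-wv j _) (cong (α j ⟨$⟩ʳ_) (φ-wv i e))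
    ; φ-bv = λ e → trans (φ-bv j _) (cong (β j ⟨$⟩ʳ_) (φ-bv i e))
    ; φ-w  = λ e → trans (φ-w j _) (φ-w i e)
    ; φ-σ  = λ e → trans (φ-σ j _) (cong (φ j ⟨$⟩ʳ_) (φ-σ i e))
    ; φ-τ  = λ e → trans (φ-τ j _) (cong (φ j ⟨$⟩ʳ_) (φ-τ i e))
    }

  iso-sym : {T₁ T₂ : WTree ks ls} → Iso T₁ T₂ → Iso T₂ T₁
  iso-sym {T₁} {T₂} i = record
    { φ    = flip (φ i)
    ; α    = flip (α i)
    ; β    = flip (β i)
    ; φ-wv = λ e → unmove (α i) (trans (sym (φ-wv i _)) (cong (wv T₂) (inverseʳ (φ i))))
    ; φ-bv = λ e → unmove (β i) (trans (sym (φ-bv i _)) (cong (bv T₂) (inverseʳ (φ i))))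
    ; φ-w  = λ e → trans (sym (φ-w i _)) (cong (w T₂) (inverseʳ (φ i)))
    ; φ-σ  = λ e → unmove (φ i) (trans (sym (φ-σ i _)) (cong (σ T₂ ⟨$⟩ʳ_) (inverseʳ (φ i))))
    ; φ-τ  = λ e → unmove (φ i) (trans (sym (φ-τ i _)) (cong (τ T₂ ⟨$⟩ʳ_) (inverseʳ (φ i))))
    }
    where
    unmove : ∀ {m n} (π : Permutation m n) {x y} → π ⟨$⟩ʳ x ≡ y → x ≡ π ⟨$⟩ˡ y
    unmove π {x} eq = trans (sym (inverseˡ π)) (cong (π ⟨$⟩ˡ_) eq)

  iso-α-weightPreserving : {T₁ T₂ : WTree ks ls} (i : Iso T₁ T₂) → WeightPreserving ks (α i)
  iso-α-weightPreserving {T₁} {T₂} i v = begin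
    lookup ks (α i ⟨$⟩ʳ v)           ≡⟨ white-wt T₂ _ ⟨
    incSum (wv T₂) (w T₂) (α i ⟨$⟩ʳ v) ≡⟨ incSum-transport (φ i) (α i) (φ-wv i) (φ-w i) v ⟩
    incSum (wv T₁) (w T₁) v           ≡⟨ white-wt T₁ v ⟩
    lookup ks v                       ∎
    where open ≡-Reasoning

  iso-β-weightPreserving : {T₁ T₂ : WTree ks ls} (i : Iso T₁ T₂) → WeightPreserving ls (β i)
  iso-β-weightPreserving {T₁} {T₂} i v = begin
    lookup ls (β i ⟨$⟩ʳ v)           ≡⟨ black-wt T₂ _ ⟨
    incSum (bv T₂) (w T₂) (β i ⟨$⟩ʳ v) ≡⟨ incSum-transport (φ i) (β i) (φ-bv i) (φ-w i) v ⟩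
    incSum (bv T₁) (w T₁) v           ≡⟨ black-wt T₁ v ⟩
    lookup ls v                       ∎
    where open ≡-Reasoning

  vertexPerm : {T₁ T₂ : WTree ks ls} → Iso T₁ T₂ → VertexPerm ks ls
  vertexPerm i = ⟨ α i , iso-α-weightPreserving i ⟩ , ⟨ β i , iso-β-weightPreserving i ⟩

  SameIso : {T₁ T₂ : WTree ks ls} → Iso T₁ T₂ → Iso T₁ T₂ → Set
  SameIso g h =
    (∀ e → φ g ⟨$⟩ʳ e ≡ φ h ⟨$⟩ʳ e) × (∀ v → α g ⟨$⟩ʳ v ≡ α h ⟨$⟩ʳ v) × (∀ v → β g ⟨$⟩ʳ v ≡ β h ⟨$⟩ʳ v)

  iso-determined-by-vertexPerm : {T₁ T₂ : WTree ks ls} (g h : Iso T₁ T₂) →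
    vertexPerm g ≈ᵥ vertexPerm h → SameIso g h
  iso-determined-by-vertexPerm {T₁} {T₂} g h (α≈ , β≈) = same-edges , α≈ , β≈
    where
    same-edges : ∀ e → φ g ⟨$⟩ʳ e ≡ φ h ⟨$⟩ʳ e
    same-edges e = no-parallel-edges (wv T₂) (bv T₂) (connected T₂) (edges T₂) _ _
      (trans (φ-wv g e) (trans (α≈ _) (sym (φ-wv h e))))
      (trans (φ-bv g e) (trans (β≈ _) (sym (φ-bv h e))))

  vertexPerm-cancelˡ : {T₁ T₂ T₃ : WTree ks ls} (χ : Iso T₁ T₂) (g h : Iso T₂ T₃) →
    vertexPerm (iso-trans χ g) ≈ᵥ vertexPerm (iso-trans χ h) → vertexPerm g ≈ᵥ vertexPerm h
  vertexPerm-cancelˡ χ g h (α≈ , β≈) = cancel (α χ) (α g) (α h) α≈ , cancel (β χ) (β g) (β h) β≈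
    where
    cancel : ∀ {n} (π ρ ρ′ : Permutation′ n) →
      (∀ v → ρ ⟨$⟩ʳ (π ⟨$⟩ʳ v) ≡ ρ′ ⟨$⟩ʳ (π ⟨$⟩ʳ v)) → ∀ v → ρ ⟨$⟩ʳ v ≡ ρ′ ⟨$⟩ʳ v
    cancel π ρ ρ′ eq v = subst (λ x → ρ ⟨$⟩ʳ x ≡ ρ′ ⟨$⟩ʳ x) (inverseʳ π) (eq (π ⟨$⟩ˡ v))

  module _ (h : VertexPerm ks ls) (T : WTree ks ls) where

    private
      a = perm (proj₁ h)
      b = perm (proj₂ h)
      wv′ = λ e → a ⟨$⟩ʳ wv T e
      bv′ = λ e → b ⟨$⟩ʳ bv T e

      relabel-vertex : Fin (length ks) ⊎ Fin (length ls) → Fin (length ks) ⊎ Fin (length ls)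
      relabel-vertex = Sum.map (a ⟨$⟩ʳ_) (b ⟨$⟩ʳ_)

      unrelabel-vertex : Fin (length ks) ⊎ Fin (length ls) → Fin (length ks) ⊎ Fin (length ls)
      unrelabel-vertex = Sum.map (a ⟨$⟩ˡ_) (b ⟨$⟩ˡ_)

      relabel-unrelabel : ∀ x → relabel-vertex (unrelabel-vertex x) ≡ x
      relabel-unrelabel (inj₁ x) = cong inj₁ (inverseʳ a)
      relabel-unrelabel (inj₂ y) = cong inj₂ (inverseʳ b)

      relabel-reach : ∀ {x y} → Reach (wv T) (bv T) x y → Reach wv′ bv′ (relabel-vertex x) (relabel-vertex y)
      relabel-reach here     = here
      relabel-reach (wb e p) = wb e (relabel-reach p)
      relabel-reach (bw e p) = bw e (relabel-reach p)

    relabel : WTree ks ls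
    relabel = record
      { E         = E T
      ; wv        = wv′
      ; bv        = bv′
      ; w         = w T
      ; σ         = σ T
      ; τ         = τ T
      ; w-pos     = w-pos T
      ; σ-fiber   = λ e → cong (a ⟨$⟩ʳ_) (σ-fiber T e)
      ; σ-cyclic  = λ e e′ eq → σ-cyclic T e e′ (permutation-injective a eq)
      ; τ-fiber   = λ e → cong (b ⟨$⟩ʳ_) (τ-fiber T e)
      ; τ-cyclic  = λ e e′ eq → τ-cyclic T e e′ (permutation-injective b eq)
      ; connected = λ x y → subst₂ (Reach wv′ bv′) (relabel-unrelabel x) (relabel-unrelabel y)
                                   (relabel-reach (connected T (unrelabel-vertex x) (unrelabel-vertex y)))
      ; edges     = edges T
      ; white-wt  = incSum-relabel (proj₁ h) (wv T) (w T) (white-wt T)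
      ; black-wt  = incSum-relabel (proj₂ h) (bv T) (w T) (black-wt T)
      }

    relabel-iso : Iso T relabel
    relabel-iso = record
      { φ = Perm.id ; α = a ; β = b
      ; φ-wv = λ _ → refl ; φ-bv = λ _ → refl ; φ-w = λ _ → refl ; φ-σ = λ _ → refl ; φ-τ = λ _ → refl }

  sameIso-isEquivalence : {T₁ T₂ : WTree ks ls} → IsEquivalence (SameIso {T₁} {T₂})
  sameIso-isEquivalence = record
    { refl  = (λ _ → refl) , (λ _ → refl) , (λ _ → refl)
    ; sym   = λ (φ≡ , α≡ , β≡) → sym ∘ φ≡ , sym ∘ α≡ , sym ∘ β≡
    ; trans = λ (φ≡ , α≡ , β≡) (φ≡′ , α≡′ , β≡′) →
        (λ e → trans (φ≡ e) (φ≡′ e)) , (λ v → trans (α≡ v) (α≡′ v)) , (λ v → trans (β≡ v) (β≡′ v))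
    }

  labelIso-from-vertexPerm : {T X Y : WTree ks ls} (t : Iso T X) (t′ : Iso T Y) →
    vertexPerm t ≈ᵥ vertexPerm t′ → LIso X Y
  labelIso-from-vertexPerm t t′ (α≈ , β≈) =
    iso-trans (iso-sym t) t′ , (λ v → trans (sym (α≈ _)) (inverseʳ (α t)))
                             , (λ v → trans (sym (β≈ _)) (inverseʳ (β t)))

-- Counting flags

module OrbitCounting {ks ls : List ℕ}
  (L : List (WTree ks ls)) (ΞL : IsΞ ks ls L) (L′ : List (WTree ks ls)) (ΞL′ : IsΞ′ ks ls L′) where

  private
    T : Fin (length L) → WTree ks ls
    T = lookup L

    T′ : Fin (length L′) → WTree ks ls
    T′ = lookup L′

    class : Fin (length L′) → Fin (length L)
    class j = proj₁ (proj₁ ΞL (T′ j))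

    ψ : ∀ j → Iso (T′ j) (T (class j))
    ψ j = proj₂ (proj₁ ΞL (T′ j))

  Flag : Set
  Flag = Σ (Fin (length L′)) (λ j → Aut (T′ j))

  _≈ᶠ_ : Flag → Flag → Set
  _≈ᶠ_ = Σ-Rel (λ j → SameAut {T = T′ j})

  Relabelling : Set
  Relabelling = Fin (length L) × VertexPerm ks ls

  _≈ʳ_ : Relabelling → Relabelling → Set
  _≈ʳ_ = Pointwise _≡_ _≈ᵥ_

  toRelabelling : Flag → Relabelling
  toRelabelling (j , g) = class j , vertexPerm (iso-trans (iso-sym (ψ j)) g)

  toRelabelling-reflects : ∀ f f′ → toRelabelling f ≈ʳ toRelabelling f′ → f ≈ᶠ f′
  toRelabelling-reflects (j , g) (j′ , g′) (same-class , g≈g′) =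
    same-flag j′ (proj₂ ΞL′ j j′ (linkVia same-class (ψ⁻¹g j g) (ψ⁻¹g j′ g′) g≈g′)) g′ g≈g′
    where
    ψ⁻¹g : ∀ j → Aut (T′ j) → Iso (T (class j)) (T′ j)
    ψ⁻¹g j g = iso-trans (iso-sym (ψ j)) g
    linkVia : ∀ {c c′} → c ≡ c′ → (t : Iso (T c) (T′ j)) (t′ : Iso (T c′) (T′ j′)) →
      vertexPerm t ≈ᵥ vertexPerm t′ → LIso (T′ j) (T′ j′)
    linkVia refl = labelIso-from-vertexPerm
    same-flag : ∀ j′ → j ≡ j′ → (g′ : Aut (T′ j′)) →
      vertexPerm (ψ⁻¹g j g) ≈ᵥ vertexPerm (ψ⁻¹g j′ g′) → (j , g) ≈ᶠ (j′ , g′)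
    same-flag _ refl g′ g≈g′ =
      refl , iso-determined-by-vertexPerm g g′ (vertexPerm-cancelˡ (iso-sym (ψ j)) g g′ g≈g′)

  private
    module Relabelled (i : Fin (length L)) (h : VertexPerm ks ls) where

      tree : WTree ks ls
      tree = relabel h (T i)

      labelled : Fin (length L′)
      labelled = proj₁ (proj₁ ΞL′ tree)

      tree≅labelled : LIso tree (T′ labelled)
      tree≅labelled = proj₂ (proj₁ ΞL′ tree)

      μ : Iso (T i) (T′ labelled)
      μ = iso-trans (relabel-iso h (T i)) (proj₁ tree≅labelled)

      μ-vertexPerm : vertexPerm μ ≈ᵥ h
      μ-vertexPerm = proj₁ (proj₂ tree≅labelled) ∘ (perm (proj₁ h) ⟨$⟩ʳ_)
                   , proj₂ (proj₂ tree≅labelled) ∘ (perm (proj₂ h) ⟨$⟩ʳ_)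

      class-labelled : class labelled ≡ i
      class-labelled = proj₂ ΞL (class labelled) i (iso-trans (iso-sym (ψ labelled)) (iso-sym μ))

      aut : Aut (T′ labelled)
      aut = iso-trans (subst (λ c → Iso (T′ labelled) (T c)) class-labelled (ψ labelled)) μ

  toFlag : Relabelling → Flag
  toFlag (i , h) = Relabelled.labelled i h , Relabelled.aut i h

  private
    aut-cancel : ∀ {j j′} (q : j ≡ j′) {i i′} (e : class j ≡ i) (e′ : class j′ ≡ i′)
      (m : Iso (T i) (T′ j)) (m′ : Iso (T i′) (T′ j′)) →
      SameAut (subst (Aut ∘ T′) q (iso-trans (subst (λ c → Iso (T′ j) (T c)) e (ψ j)) m))
              (iso-trans (subst (λ c → Iso (T′ j′) (T c)) e′ (ψ j′)) m′) →
      i ≡ i′ × vertexPerm m ≈ᵥ vertexPerm m′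
    aut-cancel {j} refl refl refl m m′ (_ , same-vertices) =
      refl , vertexPerm-cancelˡ (ψ j) m m′ same-vertices

  toFlag-reflects : ∀ r r′ → toFlag r ≈ᶠ toFlag r′ → r ≈ʳ r′
  toFlag-reflects (i , h) (i′ , h′) (q , s) =
    let open Relabelled
        (i≡i′ , (α≈ , β≈)) = aut-cancel q (class-labelled i h) (class-labelled i′ h′) (μ i h) (μ i′ h′) s
        (hα≈ , hβ≈) = μ-vertexPerm i h
        (h′α≈ , h′β≈) = μ-vertexPerm i′ h′
    in i≡i′ , (λ v → trans (sym (hα≈ v)) (trans (α≈ v) (h′α≈ v)))
            , (λ v → trans (sym (hβ≈ v)) (trans (β≈ v) (h′β≈ v)))

  module _ (ord : Fin (length L′) → ℕ) (symmetries : ∀ j → SymOrder (T′ j) (ord j)) where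

    flag-enumeration : Enumeration _≈ᶠ_ (∑[ j < length L′ ] ord j)
    flag-enumeration = enumeration-Σ ord λ j →
      let (G , |G|≡ord , covers , distinct) = symmetries j
      in subst (Enumeration SameAut) |G|≡ord
               (classList-enumeration {L = G} sameIso-isEquivalence (covers , distinct))

    relabelling-enumeration : Enumeration _≈ʳ_ (length L * pFactor ks ls)
    relabelling-enumeration =
      enumeration-× (Fin-enumeration (length L)) (enumeration-× (weightPerm-enumeration ks) (weightPerm-enumeration ls))

    ∑-symmetry-orders : ∑[ j < length L′ ] ord j ≡ pFactor ks ls * length L
    ∑-symmetry-orders = trans
      (≤-antisym (enumeration-≤ flag-enumeration relabelling-enumeration toRelabelling toRelabelling-reflects)
                 (enumeration-≤ relabelling-enumeration flag-enumeration toFlag toFlag-reflects))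
      (*-comm (length L) (pFactor ks ls))

symmetry-order-positive : ∀ {ks ls} {T : WTree ks ls} {i} → SymOrder T i → 1 ≤ i
symmetry-order-positive {T = T} (_ , |G|≡i , covers , _) =
  subst (1 ≤_) |G|≡i (m<n⇒0<n (toℕ<n (proj₁ (covers (iso-refl T)))))

theorem4 : (ks ls : List ℕ) → Positive ks → Positive ls → sum ks ≡ sum ls →
    NonSimple ks ls →
    (L : List (WTree ks ls)) → IsΞ ks ls L →
    (L′ : List (WTree ks ls)) → IsΞ′ ks ls L′ →
    (ord : Fin (length L′) → ℕ) → (∀ j → SymOrder (lookup L′ j) (ord j)) →
    (B : ℕ) → (∀ j → ord j ≤ B) →
    pFactor ks ls * length L ≡ countEq ord 1 + sumFrom2 (countEq ord) B
theorem4 ks ls _ _ _ _ L ΞL L′ ΞL′ ord symmetries B ord≤B = begin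
  pFactor ks ls * length L
    ≡⟨ OrbitCounting.∑-symmetry-orders L ΞL L′ ΞL′ ord symmetries ⟨
  ∑[ j < length L′ ] ord j
    ≡⟨ ∑-by-values ord B (symmetry-order-positive ∘ symmetries) ord≤B ⟩
  countEq ord 1 + sumFrom2 (countEq ord) B ∎
  where open ≡-Reasoning
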